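{- For every integer $i$ with $1\le i\le i_{\max}$, $$A_i(i)=\prod_{j=1}^{i}\big(\mathbf{R}^>_{i,j}+\mathbf{R}^=_{i,j}\cdot\mathbf{S}_{i-j}\big).$$
   Context: Let $\Sigma$ be a finite totally ordered alphabet with $|\Sigma|=2^b$; each letter is identified bijectively with a $b$-bit vector and $a\oplus a'$ is the letter whose bit vector is the componentwise XOR. For equal-length words, $\oplus$ acts letterwise; equal-length words are compared lexicographically. An $m$-mer of a word is a contiguous factor of length $m$. Fix integers $1\le m<k$, a word $w=a_1\cdots a_m\in\Sigma^m$ and a key $\gamma=c_1\cdots c_m\in\Sigma^m$. Iverson brackets: $[P]=1$ if $P$ holds, $0$ otherwise. Autocorrelation matrix: for $1\le j\le i\le m$, $\mathbf{R}_{i,j}\in\{<,=,>\}$ is the relation with $\big((a_j\cdots a_i)\oplus(c_1\cdots c_{i-j+1})\big)\ \mathbf{R}_{i,j}\ \big((a_1\cdots a_{i-j+1})\oplus(c_1\cdots c_{i-j+1})\big)$; $\mathbf{R}^\star_{i,j}=[\mathbf{R}_{i,j}=\star]\in\{0,1\}$. $i_{\max}=\min\big(\{m\}\cup\{2\le i\le m-1:\exists\, 2\le j\le i \text{ with } \mathbf{R}_{i,j} \text{ equal to } <\}\big)-1$. For $0\le l\le i_{\max}-1$, $\mathbf{S}_l=\Big[\big((a_1\cdots a_{m-l-1})\oplus(c_{l+2}\cdots c_m)\big)>\big((a_{l+2}\cdots a_m)\oplus(c_{l+2}\cdots c_m)\big)\Big]$. A word $y$ is an antemer if every $m$-mer $w'$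 of the word $yw$ other than the last one (the suffix $w$) satisfies $w'\oplus\gamma>w\oplus\gamma$. $A_i(\alpha)$ is the number of antemers of length $\alpha$ whose longest common prefix with $w$ has length exactly $i$ (so $A_i(i)$ counts whether $a_1\cdots a_i$ is an antemer). -}

module Defs where

open import Data.Nat using (ℕ; zero; suc; _+_; _*_; _∸_; _^_; _≡ᵇ_; _<ᵇ_)
open import Data.Bool using (Bool; true; false; _xor_; _∧_; _∨_; if_then_else_; not)
open import Data.Fin using (Fin; toℕ)
open import Data.Vec using (Vec; zipWith)
open import Data.List using (List; []; _∷_; map; take; drop; length; _++_; filterᵇ; upTo; concatMap; foldr)
open import Data.Bool.ListAction using (any; all)
open import Data.Nat.ListAction using (product)
import Data.List as L
open import Data.Fin.Base using ()
open import Function.Bundles using (_↔_; Inverse)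

data Cmp : Set where
  lt eq gt : Cmp

cmpℕ : ℕ → ℕ → Cmp
cmpℕ zero zero = eq
cmpℕ zero (suc _) = lt
cmpℕ (suc _) zero = gt
cmpℕ (suc m) (suc n) = cmpℕ m n

isLt isEq isGt : Cmp → Bool
isLt lt = true
isLt _  = false
isEq eq = true
isEq _  = false
isGt gt = true
isGt _  = false

⟦_⟧ : Bool → ℕ
⟦ true ⟧  = 1
⟦ false ⟧ = 0

-- integers a, a+1, ..., b (empty if b < a)
fromTo : ℕ → ℕ → List ℕ
fromTo a b = map (a +_) (upTo (suc b ∸ a))

-- The alphabet is Fin (2 ^ b) with its natural total order (every finite
-- totally ordered set of size 2^b is order-isomorphic to it); the bijective
-- identification with b-bit vectors is an arbitrary bijection `enc`.
module Setup (b : ℕ) (enc : Fin (2 ^ b) ↔ Vec Bool b) where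

  Letter : Set
  Letter = Fin (2 ^ b)

  Word : Set
  Word = List Letter

  open Inverse enc using (to; from)

  _⊕ₗ_ : Letter → Letter → Letter
  x ⊕ₗ y = from (zipWith _xor_ (to x) (to y))

  _⊕_ : Word → Word → Word
  (x ∷ xs) ⊕ (y ∷ ys) = (x ⊕ₗ y) ∷ (xs ⊕ ys)
  _ ⊕ _ = []

  cmpW : Word → Word → Cmp
  cmpW (x ∷ xs) (y ∷ ys) with cmpℕ (toℕ x) (toℕ y)
  ... | eq = cmpW xs ys
  ... | c  = c
  cmpW [] [] = eq
  cmpW [] (_ ∷ _) = lt
  cmpW (_ ∷ _) [] = gt

  -- 1-based factor u_j ... u_i
  factor : Word → ℕ → ℕ → Word
  factor u j i = take (suc i ∸ j) (drop (j ∸ 1) u)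

  lcp : Word → Word → ℕ
  lcp (x ∷ xs) (y ∷ ys) = if toℕ x ≡ᵇ toℕ y then suc (lcp xs ys) else 0
  lcp _ _ = 0

  allWords : ℕ → List Word
  allWords zero = [] ∷ []
  allWords (suc n) = concatMap (λ x → map (x ∷_) (allWords n)) (L.allFin (2 ^ b))

  module WithWord (m : ℕ) (w γ : Word) where

    R : ℕ → ℕ → Cmp
    R i j = cmpW (factor w j i ⊕ factor γ 1 (suc i ∸ j))
                 (factor w 1 (suc i ∸ j) ⊕ factor γ 1 (suc i ∸ j))

    R> R= : ℕ → ℕ → ℕ
    R> i j = ⟦ isGt (R i j) ⟧
    R= i j = ⟦ isEq (R i j) ⟧

    bad : ℕ → Bool
    bad i = any (λ j → isLt (R i j)) (fromTo 2 i)

    -- i_max = min({m} ∪ {2 ≤ i ≤ m-1 : bad i}) - 1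
    imax : ℕ
    imax = foldr (λ i acc → if bad i then i else acc) m (fromTo 2 (m ∸ 1)) ∸ 1

    S : ℕ → ℕ
    S l = ⟦ isGt (cmpW (factor w 1 (m ∸ l ∸ 1) ⊕ factor γ (l + 2) m)
                        (factor w (l + 2) m ⊕ factor γ (l + 2) m)) ⟧

    -- y is an antemer: every m-mer of y w except the last one (the suffix w)
    -- satisfies w' ⊕ γ > w ⊕ γ
    isAntemer : Word → Bool
    isAntemer y = all (λ p → isGt (cmpW (take m (drop p (y ++ w)) ⊕ γ) (w ⊕ γ)))
                      (upTo (length y))

    A : ℕ → ℕ → ℕ
    A i α = length (filterᵇ (λ y → isAntemer y ∧ (lcp y w ≡ᵇ i)) (allWords α))

    rhs : ℕ → ℕ
    rhs i = product (map (λ j → R> i j + R= i j * S (i ∸ j)) (fromTo 1 i))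

-- Among the words of length i, only the prefix a₁⋯aᵢ of w has a
-- common prefix of length i with w, so A_i(i) is the Iverson bracket of
-- "a₁⋯aᵢ is an antemer", i.e. the product over the m-mers of a₁⋯aᵢw other
-- than the last.  The m-mer starting at position j is aⱼ⋯aᵢ a₁⋯a_{m-i+j-1};
-- compared (after ⊕ γ) lexicographically with w, its first i-j+1 letters give
-- R_{i,j}, and only on a tie the remaining letters decide, which is S_{i-j}.
-- This argument works for every i ≤ m: i_max enters only through i_max ≤ m.
module Submission where

open import Defs
open import Data.Nat using (ℕ; _^_; _≤_; _<_)
open import Data.Bool using (Bool)
open import Data.Fin using (Fin)
open import Data.Vec using (Vec; toList)
open import Function.Bundles using (_↔_)
open import Relation.Binary.PropositionalEquality using (_≡_)

open import Data.Nat using (zero; suc; _+_; _*_; _∸_; _≡ᵇ_; s≤s)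
open import Data.Nat.Properties
open import Data.Bool using (true; false; _∧_; if_then_else_; T)
open import Data.Bool.Properties using (∧-zeroʳ; ∧-identityʳ)
open import Data.Fin using (toℕ; zero; suc)
import Data.Fin.Properties as Finₚ
open import Data.List using (List; []; _∷_; map; take; drop; length; _++_; filterᵇ; upTo; concat; concatMap; foldr; tabulate)
open import Data.List.Properties
  using (++-identityʳ; filter-++; map-tabulate; map-cong-local; map-∘; length-take; length-drop; take-[]; take-all; take++drop≡id)
open import Data.List.Relation.Unary.All using (All; []; _∷_)
import Data.List.Relation.Unary.All as All
open import Data.List.Relation.Unary.All.Properties using (map⁺; applyUpTo⁺₁)
open import Data.Bool.ListAction using (all)
open import Data.Nat.ListAction using (product)
open import Data.Vec.Properties using (length-toList)
open import Relation.Binary.PropositionalEquality using (_≢_; refl; sym; trans; cong; cong₂; subst; module ≡-Reasoning)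
open import Relation.Nullary using (contradiction)
open import Function using (_∘_; id)

open ≡-Reasoning

private
  variable
    C D : Set

⟦∧⟧ : ∀ x y → ⟦ x ∧ y ⟧ ≡ ⟦ x ⟧ * ⟦ y ⟧
⟦∧⟧ true  y = sym (+-identityʳ _)
⟦∧⟧ false y = refl

⟦all⟧ : ∀ (p : C → Bool) xs → ⟦ all p xs ⟧ ≡ product (map (⟦_⟧ ∘ p) xs)
⟦all⟧ p []       = refl
⟦all⟧ p (x ∷ xs) = trans (⟦∧⟧ (p x) (all p xs)) (cong (⟦ p x ⟧ *_) (⟦all⟧ p xs))

length-filterᵇ-[_] : ∀ (p : C → Bool) x → length (filterᵇ p (x ∷ [])) ≡ ⟦ p x ⟧
length-filterᵇ-[ p ] x with p x
... | true  = refl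
... | false = refl

≢⇒≡ᵇ≡false : ∀ m n → m ≢ n → (m ≡ᵇ n) ≡ false
≢⇒≡ᵇ≡false m n m≢n with m ≡ᵇ n in eq
... | true  = contradiction (≡ᵇ⇒≡ m n (subst T (sym eq) _)) m≢n
... | false = refl

≡ᵇ-refl : ∀ n → (n ≡ᵇ n) ≡ true
≡ᵇ-refl zero    = refl
≡ᵇ-refl (suc n) = ≡ᵇ-refl n

filterᵇ-none : ∀ (p : C → Bool) → (∀ x → p x ≡ false) → ∀ xs → filterᵇ p xs ≡ []
filterᵇ-none p none []       = refl
filterᵇ-none p none (x ∷ xs) rewrite none x = filterᵇ-none p none xs

filterᵇ-∧ : ∀ (p q : C → Bool) xs → filterᵇ (λ x → p x ∧ q x) xs ≡ filterᵇ p (filterᵇ q xs)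
filterᵇ-∧ p q []       = refl
filterᵇ-∧ p q (x ∷ xs) with q x
... | false rewrite ∧-zeroʳ (p x) = filterᵇ-∧ p q xs
... | true rewrite ∧-identityʳ (p x) with p x
...   | true  = cong (x ∷_) (filterᵇ-∧ p q xs)
...   | false = filterᵇ-∧ p q xs

filterᵇ-map : ∀ (p : D → Bool) (f : C → D) xs → filterᵇ p (map f xs) ≡ map f (filterᵇ (p ∘ f) xs)
filterᵇ-map p f []       = refl
filterᵇ-map p f (x ∷ xs) with p (f x)
... | true  = cong (f x ∷_) (filterᵇ-map p f xs)
... | false = filterᵇ-map p f xs

filterᵇ-concatMap : ∀ (p : D → Bool) (g : C → List D) xs →
  filterᵇ p (concatMap g xs) ≡ concatMap (filterᵇ p ∘ g) xs
filterᵇ-concatMap p g []       = refl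
filterᵇ-concatMap p g (x ∷ xs) =
  trans (filter-++ _ (g x) (concatMap g xs)) (cong (filterᵇ p (g x) ++_) (filterᵇ-concatMap p g xs))

concat-tabulate-single : ∀ {n} (f : Fin n → List C) a → (∀ x → x ≢ a → f x ≡ []) → concat (tabulate f) ≡ f a
concat-tabulate-single {n = suc n} f zero others =
  trans (cong (f zero ++_) (concat-tabulate-nil (f ∘ suc) (λ x → others (suc x) λ ()))) (++-identityʳ (f zero))
  where
  concat-tabulate-nil : ∀ {k} (g : Fin k → List C) → (∀ x → g x ≡ []) → concat (tabulate g) ≡ []
  concat-tabulate-nil {k = zero}  g nil = refl
  concat-tabulate-nil {k = suc k} g nil rewrite nil zero = concat-tabulate-nil (g ∘ suc) (nil ∘ suc)
concat-tabulate-single {n = suc n} f (suc a) others rewrite others zero (λ ()) =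
  concat-tabulate-single (f ∘ suc) a (λ x x≢a → others (suc x) (x≢a ∘ Finₚ.suc-injective))

drop-take : ∀ p i (xs : List C) → drop p (take i xs) ≡ take (i ∸ p) (drop p xs)
drop-take zero    i       xs       = refl
drop-take (suc p) zero    xs       = refl
drop-take (suc p) (suc i) []       = sym (take-[] (i ∸ p))
drop-take (suc p) (suc i) (x ∷ xs) = drop-take p i xs

drop-++ : ∀ p (xs ys : List C) → p ≤ length xs → drop p (xs ++ ys) ≡ drop p xs ++ ys
drop-++ zero    xs       ys _         = refl
drop-++ (suc p) (x ∷ xs) ys (s≤s p≤n) = drop-++ p xs ys p≤n

take-++ : ∀ n (xs ys : List C) → length xs ≤ n → take n (xs ++ ys) ≡ xs ++ take (n ∸ length xs) ys
take-++ n       []       ys _         = refl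
take-++ (suc n) (x ∷ xs) ys (s≤s l≤n) = cong (x ∷_) (take-++ n xs ys l≤n)

length-take-≤ : ∀ n (xs : List C) → n ≤ length xs → length (take n xs) ≡ n
length-take-≤ n xs n≤l = trans (length-take n xs) (m≤n⇒m⊓n≡m n≤l)

take-drop-take-++ : ∀ m p i (u v : List C) → p ≤ i → i ≤ length u → i ∸ p ≤ m →
  take m (drop p (take i u ++ v)) ≡ take (i ∸ p) (drop p u) ++ take (m ∸ (i ∸ p)) v
take-drop-take-++ m p i u v p≤i i≤∣u∣ i∸p≤m = begin
    take m (drop p (take i u ++ v))
  ≡⟨ cong (take m) (drop-++ p (take i u) v (≤-trans p≤i (≤-reflexive (sym ∣take-i∣)))) ⟩
    take m (drop p (take i u) ++ v)
  ≡⟨ cong (λ z → take m (z ++ v)) (drop-take p i u) ⟩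
    take m (X ++ v)
  ≡⟨ take-++ m X v (≤-trans (≤-reflexive ∣X∣) i∸p≤m) ⟩
    X ++ take (m ∸ length X) v
  ≡⟨ cong (λ n → X ++ take (m ∸ n) v) ∣X∣ ⟩
    X ++ take (m ∸ (i ∸ p)) v
  ∎
  where
  X = take (i ∸ p) (drop p u)
  ∣take-i∣ : length (take i u) ≡ i
  ∣take-i∣ = length-take-≤ i u i≤∣u∣
  ∣X∣ : length X ≡ i ∸ p
  ∣X∣ = length-take-≤ (i ∸ p) (drop p u) (subst (i ∸ p ≤_) (sym (length-drop p u)) (∸-monoˡ-≤ p i≤∣u∣))

fromTo-≤ : ∀ a b → All (_≤ b) (fromTo a b)
fromTo-≤ a b = map⁺ (applyUpTo⁺₁ id (suc b ∸ a) (bound a b))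
  where
  bound : ∀ a b {q} → q < suc b ∸ a → a + q ≤ b
  bound zero          b       (s≤s q≤b) = q≤b
  bound (suc zero)    zero    ()
  bound (suc (suc a)) zero    ()
  bound (suc a)       (suc b) q<b+1-a   = s≤s (bound a b q<b+1-a)

foldr-select-≤ : ∀ (f : ℕ → Bool) n xs → All (_≤ n) xs → foldr (λ x acc → if f x then x else acc) n xs ≤ n
foldr-select-≤ f n []       []           = ≤-refl
foldr-select-≤ f n (x ∷ xs) (x≤n ∷ xs≤n) with f x
... | true  = x≤n
... | false = foldr-select-≤ f n xs xs≤n

lex : Cmp → Cmp → Cmp
lex eq d = d
lex c  _ = c

⟦isGt-lex⟧ : ∀ c d → ⟦ isGt (lex c d) ⟧ ≡ ⟦ isGt c ⟧ + ⟦ isEq c ⟧ * ⟦ isGt d ⟧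
⟦isGt-lex⟧ lt d = refl
⟦isGt-lex⟧ eq d = sym (+-identityʳ _)
⟦isGt-lex⟧ gt d = refl

module Words (b : ℕ) (enc : Fin (2 ^ b) ↔ Vec Bool b) where
  open Setup b enc

  filterᵇ-lcp-∷ : ∀ n x a (u : Word) ys →
    filterᵇ (λ y → lcp y (a ∷ u) ≡ᵇ suc n) (map (x ∷_) ys)
      ≡ (if toℕ x ≡ᵇ toℕ a then map (x ∷_) (filterᵇ (λ y → lcp y u ≡ᵇ n) ys) else [])
  filterᵇ-lcp-∷ n x a u ys rewrite filterᵇ-map (λ y → lcp y (a ∷ u) ≡ᵇ suc n) (x ∷_) ys
    with toℕ x ≡ᵇ toℕ a
  ... | true  = refl
  ... | false = cong (map (x ∷_)) (filterᵇ-none _ (λ _ → refl) ys)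

  allWords-lcp≡ : ∀ n (u : Word) → n ≤ length u →
    filterᵇ (λ y → lcp y u ≡ᵇ n) (allWords n) ≡ take n u ∷ []
  allWords-lcp≡ zero    u       _         = refl
  allWords-lcp≡ (suc n) (a ∷ u) (s≤s n≤l) = begin
      filterᵇ P (concatMap extend (tabulate id))
    ≡⟨ filterᵇ-concatMap P extend (tabulate id) ⟩
      concat (map (filterᵇ P ∘ extend) (tabulate id))
    ≡⟨ cong concat (map-tabulate id (filterᵇ P ∘ extend)) ⟩
      concat (tabulate (filterᵇ P ∘ extend))
    ≡⟨ concat-tabulate-single (filterᵇ P ∘ extend) a others ⟩
      filterᵇ P (extend a)
    ≡⟨ filterᵇ-lcp-∷ n a a u (allWords n) ⟩
      (if toℕ a ≡ᵇ toℕ a then map (a ∷_) (filterᵇ Q (allWords n)) else [])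
    ≡⟨ cong (λ c → if c then map (a ∷_) (filterᵇ Q (allWords n)) else []) (≡ᵇ-refl (toℕ a)) ⟩
      map (a ∷_) (filterᵇ Q (allWords n))
    ≡⟨ cong (map (a ∷_)) (allWords-lcp≡ n u n≤l) ⟩
      (a ∷ take n u) ∷ []
    ∎
    where
    P : Word → Bool
    P y = lcp y (a ∷ u) ≡ᵇ suc n
    Q : Word → Bool
    Q y = lcp y u ≡ᵇ n
    extend : Letter → List Word
    extend x = map (x ∷_) (allWords n)
    others : ∀ x → x ≢ a → filterᵇ P (extend x) ≡ []
    others x x≢a rewrite filterᵇ-lcp-∷ n x a u (allWords n)
                       | ≢⇒≡ᵇ≡false (toℕ x) (toℕ a) (x≢a ∘ Finₚ.toℕ-injective) = refl

  cmpW-++-⊕ : ∀ n (xs ys us vs zs : Word) → length xs ≡ n → length ys ≡ n → n ≤ length zs →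
    cmpW ((xs ++ us) ⊕ zs) ((ys ++ vs) ⊕ zs)
      ≡ lex (cmpW (xs ⊕ take n zs) (ys ⊕ take n zs)) (cmpW (us ⊕ drop n zs) (vs ⊕ drop n zs))
  cmpW-++-⊕ zero    []       []       us vs zs       _  _  _         = refl
  cmpW-++-⊕ (suc n) (x ∷ xs) (y ∷ ys) us vs (z ∷ zs) ∣xs∣ ∣ys∣ (s≤s n≤l)
    with cmpℕ (toℕ (x ⊕ₗ z)) (toℕ (y ⊕ₗ z))
  ... | lt = refl
  ... | eq = cmpW-++-⊕ n xs ys us vs zs (suc-injective ∣xs∣) (suc-injective ∣ys∣) n≤l
  ... | gt = refl

  module Antemers (m : ℕ) (w γ : Word) (∣w∣≡m : length w ≡ m) (∣γ∣≡m : length γ ≡ m) where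
    open WithWord m w γ

    tailCmp : ℕ → Cmp
    tailCmp L = cmpW (take (m ∸ L) w ⊕ drop L γ) (drop L w ⊕ drop L γ)

    S≡⟦tailCmp⟧ : ∀ l → S l ≡ ⟦ isGt (tailCmp (suc l)) ⟧
    S≡⟦tailCmp⟧ l rewrite +-comm l 2 | ∸-+-assoc m l 1 | +-comm l 1 =
      cong₂ (λ u v → ⟦ isGt (cmpW (take (m ∸ suc l) w ⊕ u) (v ⊕ u)) ⟧) (take-drop-all γ ∣γ∣≡m) (take-drop-all w ∣w∣≡m)
      where
      take-drop-all : ∀ z → length z ≡ m → take (m ∸ suc l) (drop (suc l) z) ≡ drop (suc l) z
      take-drop-all z ∣z∣≡m = take-all (m ∸ suc l) (drop (suc l) z)
        (≤-reflexive (trans (length-drop (suc l) z) (cong (_∸ suc l) ∣z∣≡m)))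

    mmer-cmp : ∀ p i → p ≤ i → i ≤ m →
      cmpW (take m (drop p (take i w ++ w)) ⊕ γ) (w ⊕ γ) ≡ lex (R i (suc p)) (tailCmp (i ∸ p))
    mmer-cmp p i p≤i i≤m = begin
        cmpW (take m (drop p (take i w ++ w)) ⊕ γ) (w ⊕ γ)
      ≡⟨ cong₂ (λ u v → cmpW (u ⊕ γ) (v ⊕ γ)) (take-drop-take-++ m p i w w p≤i i≤∣w∣ L≤m) (sym (take++drop≡id L w)) ⟩
        cmpW ((take L (drop p w) ++ take (m ∸ L) w) ⊕ γ) ((take L w ++ drop L w) ⊕ γ)
      ≡⟨ cmpW-++-⊕ L (take L (drop p w)) (take L w) _ _ γ
           (length-take-≤ L (drop p w) L≤∣drop-p-w∣) (length-take-≤ L w (≤-trans L≤m (≤-reflexive (sym ∣w∣≡m))))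
           (≤-trans L≤m (≤-reflexive (sym ∣γ∣≡m))) ⟩
        lex (R i (suc p)) (tailCmp L)
      ∎
      where
      L = i ∸ p
      i≤∣w∣ : i ≤ length w
      i≤∣w∣ = ≤-trans i≤m (≤-reflexive (sym ∣w∣≡m))
      L≤m : L ≤ m
      L≤m = ≤-trans (m∸n≤m i p) i≤m
      L≤∣drop-p-w∣ : L ≤ length (drop p w)
      L≤∣drop-p-w∣ = subst (L ≤_) (sym (length-drop p w)) (∸-monoˡ-≤ p i≤∣w∣)

    mmer-factor : ∀ i p → i ≤ m → p < i →
      ⟦ isGt (cmpW (take m (drop p (take i w ++ w)) ⊕ γ) (w ⊕ γ)) ⟧ ≡ R> i (suc p) + R= i (suc p) * S (i ∸ suc p)
    mmer-factor (suc i) p i≤m (s≤s p≤i) = begin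
        ⟦ isGt (cmpW (take m (drop p (take (suc i) w ++ w)) ⊕ γ) (w ⊕ γ)) ⟧
      ≡⟨ cong (⟦_⟧ ∘ isGt) (mmer-cmp p (suc i) (m≤n⇒m≤1+n p≤i) i≤m) ⟩
        ⟦ isGt (lex (R (suc i) (suc p)) (tailCmp (suc i ∸ p))) ⟧
      ≡⟨ ⟦isGt-lex⟧ (R (suc i) (suc p)) (tailCmp (suc i ∸ p)) ⟩
        R> (suc i) (suc p) + R= (suc i) (suc p) * ⟦ isGt (tailCmp (suc i ∸ p)) ⟧
      ≡⟨ cong (λ L → R> (suc i) (suc p) + R= (suc i) (suc p) * ⟦ isGt (tailCmp L) ⟧) (+-∸-assoc 1 p≤i) ⟩
        R> (suc i) (suc p) + R= (suc i) (suc p) * ⟦ isGt (tailCmp (suc (i ∸ p))) ⟧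
      ≡⟨ cong (λ s → R> (suc i) (suc p) + R= (suc i) (suc p) * s) (sym (S≡⟦tailCmp⟧ (i ∸ p))) ⟩
        R> (suc i) (suc p) + R= (suc i) (suc p) * S (i ∸ p)
      ∎

    ⟦isAntemer-take⟧ : ∀ i → i ≤ m → ⟦ isAntemer (take i w) ⟧ ≡ rhs i
    ⟦isAntemer-take⟧ i i≤m = begin
        ⟦ isAntemer (take i w) ⟧
      ≡⟨ ⟦all⟧ mmer> (upTo (length (take i w))) ⟩
        product (map (⟦_⟧ ∘ mmer>) (upTo (length (take i w))))
      ≡⟨ cong (λ n → product (map (⟦_⟧ ∘ mmer>) (upTo n))) (length-take-≤ i w (≤-trans i≤m (≤-reflexive (sym ∣w∣≡m)))) ⟩
        product (map (⟦_⟧ ∘ mmer>) (upTo i))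
      ≡⟨ cong product (map-cong-local (applyUpTo⁺₁ id i (mmer-factor i _ i≤m))) ⟩
        product (map (factorᵢ ∘ suc) (upTo i))
      ≡⟨ cong product (map-∘ (upTo i)) ⟩
        rhs i
      ∎
      where
      mmer> : ℕ → Bool
      mmer> p = isGt (cmpW (take m (drop p (take i w ++ w)) ⊕ γ) (w ⊕ γ))
      factorᵢ : ℕ → ℕ
      factorᵢ j = R> i j + R= i j * S (i ∸ j)

    imax≤m : imax ≤ m
    imax≤m = ≤-trans (m∸n≤m _ 1)
      (foldr-select-≤ bad m (fromTo 2 (m ∸ 1)) (All.map (λ x≤m-1 → ≤-trans x≤m-1 (m∸n≤m m 1)) (fromTo-≤ 2 (m ∸ 1))))

    A-diagonal : ∀ i → i ≤ m → A i i ≡ rhs i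
    A-diagonal i i≤m = begin
        length (filterᵇ (λ y → isAntemer y ∧ (lcp y w ≡ᵇ i)) (allWords i))
      ≡⟨ cong length (filterᵇ-∧ isAntemer (λ y → lcp y w ≡ᵇ i) (allWords i)) ⟩
        length (filterᵇ isAntemer (filterᵇ (λ y → lcp y w ≡ᵇ i) (allWords i)))
      ≡⟨ cong (length ∘ filterᵇ isAntemer) (allWords-lcp≡ i w (≤-trans i≤m (≤-reflexive (sym ∣w∣≡m)))) ⟩
        length (filterᵇ isAntemer (take i w ∷ []))
      ≡⟨ length-filterᵇ-[ isAntemer ] (take i w) ⟩
        ⟦ isAntemer (take i w) ⟧
      ≡⟨ ⟦isAntemer-take⟧ i i≤m ⟩
        rhs i
      ∎

lemma3 : (b : ℕ) (enc : Fin (2 ^ b) ↔ Vec Bool b) (m k : ℕ) → 1 ≤ m → m < k →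
         (w γ : Vec (Fin (2 ^ b)) m) → (i : ℕ) →
         1 ≤ i → i ≤ Setup.WithWord.imax b enc m (toList w) (toList γ) →
         Setup.WithWord.A b enc m (toList w) (toList γ) i i
           ≡ Setup.WithWord.rhs b enc m (toList w) (toList γ) i
lemma3 b enc m k _ _ w γ i _ i≤imax = A-diagonal i (≤-trans i≤imax imax≤m)
  where open Words.Antemers b enc m (toList w) (toList γ) (length-toList w) (length-toList γ)
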